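{- Let $m\geq 1$ and let $G$ be an empty (edgeless) graph with $m$ vertices. For any finite simple graph $H$, the lexicographic product $G\circ H$ is well-f-covered if and only if $H$ is well-f-covered; moreover, $f(G\circ H)=m\,f(H)$.
   Context: All graphs are finite and simple. An empty graph is a graph with no edges. The lexicographic product $G\circ H$ has vertex set $V(G)\times V(H)$, with $(g,h)$ adjacent to $(g',h')$ if and only if either $g$ is adjacent to $g'$ in $G$, or $g=g'$ and $h$ is adjacent to $h'$ in $H$. A forest in a graph $G$ means an induced subgraph $G[X]$ ($X\subseteq V(G)$) containing no cycle; it is a maximal forest if no vertex set properly containing $X$ induces an acyclic subgraph. The forest number $f(G)$ is the maximum order of a forest in $G$. A graph is well-f-covered if all its maximal forests have the same order (necessarily $f(G)$). -}

module Defs where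

open import Data.Nat using (ℕ; _*_; _≤_; _+_)
open import Data.Fin using (Fin; zero; suc; fromℕ; inject₁; remQuot)
open import Data.Fin.Subset using (Subset; _∈_; _⊂_; ∣_∣)
open import Data.Product using (Σ; _×_; _,_; proj₁; proj₂)
open import Data.Sum using (_⊎_; inj₁; inj₂)
open import Data.Empty using (⊥)
open import Relation.Nullary using (¬_)
open import Relation.Binary.PropositionalEquality using (_≡_; refl; sym)
open import Function.Definitions using (Injective)

record Graph : Set₁ where
  field
    n      : ℕ
    Adj    : Fin n → Fin n → Set
    adj-sym : ∀ {i j} → Adj i j → Adj j i
    irrefl : ∀ {i} → ¬ Adj i i

open Graph public

Edgeless : Graph → Set
Edgeless G = ∀ i j → ¬ Adj G i j

_∘ₗ_ : Graph → Graph → Graph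
G ∘ₗ H = record
  { n      = n G * n H
  ; Adj    = LAdj
  ; adj-sym = LSym
  ; irrefl = LIrr
  }
  where
    fst : Fin (n G * n H) → Fin (n G)
    fst u = proj₁ (remQuot {n G} (n H) u)
    snd : Fin (n G * n H) → Fin (n H)
    snd u = proj₂ (remQuot {n G} (n H) u)
    LAdj : Fin (n G * n H) → Fin (n G * n H) → Set
    LAdj u v = Adj G (fst u) (fst v) ⊎ ((fst u ≡ fst v) × Adj H (snd u) (snd v))
    LSym : ∀ {u v} → LAdj u v → LAdj v u
    LSym (inj₁ a) = inj₁ (Graph.adj-sym G a)
    LSym (inj₂ (e , a)) = inj₂ (sym e , Graph.adj-sym H a)
    LIrr : ∀ {u} → ¬ LAdj u u
    LIrr (inj₁ a) = irrefl G a
    LIrr (inj₂ (_ , a)) = irrefl H a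

-- A cycle of length k+3 in the induced subgraph G[X]: pairwise distinct
-- vertices c 0, …, c (k+2), all in X, with c i ~ c (i+1) and c (k+2) ~ c 0.
record CycleIn (G : Graph) (X : Subset (n G)) : Set where
  field
    len    : ℕ
    c      : Fin (3 + len) → Fin (n G)
    inj    : Injective _≡_ _≡_ c
    inX    : ∀ i → c i ∈ X
    step   : ∀ (i : Fin (2 + len)) → Adj G (c (inject₁ i)) (c (suc i))
    close  : Adj G (c (fromℕ (2 + len))) (c zero)

Forest : (G : Graph) → Subset (n G) → Set
Forest G X = ¬ CycleIn G X

MaximalForest : (G : Graph) → Subset (n G) → Set
MaximalForest G X = Forest G X × (∀ Y → X ⊂ Y → ¬ Forest G Y)

IsForestNumber : Graph → ℕ → Set
IsForestNumber G k =
  Σ (Subset (n G)) (λ X → Forest G X × ∣ X ∣ ≡ k)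
  × (∀ X → Forest G X → ∣ X ∣ ≤ k)

WellFCovered : Graph → Set
WellFCovered G = ∀ X Y → MaximalForest G X → MaximalForest G Y → ∣ X ∣ ≡ ∣ Y ∣

-- As G has no edges, G ∘ H is the disjoint union of m layers, each a copy of H.
-- A cycle stays inside one layer, so X induces a forest iff each of its m
-- slices does; enlarging a single slice then shows that every slice of a
-- maximal forest is maximal, and m copies of a maximal forest of H form a
-- maximal forest of G ∘ H. Sizes of maximal forests of G ∘ H are therefore
-- sums of m sizes of maximal forests of H, and conversely m times any such
-- size occurs; this gives both the equivalence and f(G ∘ H) = m f(H).
module Submission where

open import Defs
open import Data.Nat using (ℕ; zero; suc; _+_; _*_; _≤_; z≤n; >-nonZero)
open import Data.Nat.Properties using (*-cancelˡ-≡; +-mono-≤; ≤-reflexive; ≤-trans)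
open import Data.Product using (∃; _×_; _,_; proj₁; proj₂)
open import Data.Sum using (inj₁; inj₂)
open import Data.Empty using (⊥-elim)
open import Data.Bool using (true; false)
open import Data.Fin using (Fin; zero; suc; remQuot; combine; _≟_)
open import Data.Fin.Induction using (<-weakInduction)
open import Data.Fin.Properties using (remQuot-combine; combine-remQuot; combine-injectiveʳ)
open import Data.Fin.Subset using (Subset; _∈_; _⊆_; _⊂_; ∣_∣)
open import Data.Vec using (Vec; []; _∷_; _++_; lookup; concat; replicate; group; _[_]≔_)
open import Data.Vec.Properties
  using (lookup-concat; lookup-replicate; lookup∘update; lookup∘update′; []=⇒lookup; lookup⇒[]=)
open import Relation.Nullary using (yes; no)
open import Relation.Binary.PropositionalEquality
open import Function using (_∘_)
open import Function.Bundles using (_⇔_; mk⇔)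

private
  variable
    A : Set
    m k : ℕ

∀-update : (P : Fin m → A → Set) (S : Vec A m) {g : Fin m} {x : A} →
           P g x → (∀ i → P i (lookup S i)) → ∀ i → P i (lookup (S [ g ]≔ x) i)
∀-update P S {g} {x} Pgx PS i with i ≟ g
... | yes refl = subst (P g) (sym (lookup∘update g S x)) Pgx
... | no i≢g   = subst (P i) (sym (lookup∘update′ i≢g S x)) (PS i)

module Blocks (m k : ℕ) where

  row : Fin (m * k) → Fin m
  row u = proj₁ (remQuot {m} k u)

  col : Fin (m * k) → Fin k
  col u = proj₂ (remQuot {m} k u)

  combine-row-col : (u : Fin (m * k)) → combine (row u) (col u) ≡ u
  combine-row-col u = combine-remQuot {m} k u

  row-combine : (g : Fin m) (h : Fin k) → row (combine g h) ≡ g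
  row-combine g h = cong proj₁ (remQuot-combine {m} {k} g h)

  col-combine : (g : Fin m) (h : Fin k) → col (combine g h) ≡ h
  col-combine g h = cong proj₂ (remQuot-combine {m} {k} g h)

  ∈-concat⁺ : ∀ (S : Vec (Subset k) m) {g h} → h ∈ lookup S g → combine g h ∈ concat S
  ∈-concat⁺ S {g} {h} p = lookup⇒[]= _ _ (trans (lookup-concat S g h) ([]=⇒lookup p))

  ∈-concat⁻ : ∀ (S : Vec (Subset k) m) {g h} → combine g h ∈ concat S → h ∈ lookup S g
  ∈-concat⁻ S {g} {h} p = lookup⇒[]= _ _ (trans (sym (lookup-concat S g h)) ([]=⇒lookup p))

  ∈-concat⁺′ : ∀ (S : Vec (Subset k) m) {u} → col u ∈ lookup S (row u) → u ∈ concat S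
  ∈-concat⁺′ S {u} p = subst (_∈ concat S) (combine-row-col u) (∈-concat⁺ S p)

  ∈-concat⁻′ : ∀ (S : Vec (Subset k) m) {u} → u ∈ concat S → col u ∈ lookup S (row u)
  ∈-concat⁻′ S {u} p = ∈-concat⁻ S (subst (_∈ concat S) (sym (combine-row-col u)) p)

  concat-⊆ : ∀ (S T : Vec (Subset k) m) →
             (∀ g → lookup S g ⊆ lookup T g) → concat S ⊆ concat T
  concat-⊆ S T S⊆T p = ∈-concat⁺′ T (S⊆T _ (∈-concat⁻′ S p))

  concat-⊂⁻ : ∀ (S T : Vec (Subset k) m) →
              concat S ⊂ concat T → ∃ λ g → lookup S g ⊂ lookup T g
  concat-⊂⁻ S T (S⊆T , u , u∈T , u∉S) =
    row u , (λ p → ∈-concat⁻ T (S⊆T (∈-concat⁺ S p))) ,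
    col u , ∈-concat⁻′ T u∈T , λ p → u∉S (∈-concat⁺′ S p)

  concat-⊂-update : ∀ (S : Vec (Subset k) m) {g : Fin m} {Z : Subset k} →
                    lookup S g ⊂ Z → concat S ⊂ concat (S [ g ]≔ Z)
  concat-⊂-update S {g} {Z} (S⊆Z , h , h∈Z , h∉S) =
    concat-⊆ S (S [ g ]≔ Z) (∀-update (λ i B → lookup S i ⊆ B) S S⊆Z (λ _ p → p)) ,
    combine g h ,
    ∈-concat⁺ (S [ g ]≔ Z) (subst (h ∈_) (sym (lookup∘update g S Z)) h∈Z) ,
    λ p → h∉S (∈-concat⁻ S p)

  slices : Subset (m * k) → Vec (Subset k) m
  slices X = proj₁ (group m k X)

  concat-slices : (X : Subset (m * k)) → concat (slices X) ≡ X
  concat-slices X = sym (proj₂ (group m k X))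

  ∣concat-slices∣ : (X : Subset (m * k)) → ∣ concat (slices X) ∣ ≡ ∣ X ∣
  ∣concat-slices∣ X = cong ∣_∣ (concat-slices X)

∣++∣ : ∀ (p : Subset m) (q : Subset k) → ∣ p ++ q ∣ ≡ ∣ p ∣ + ∣ q ∣
∣++∣ []          q = refl
∣++∣ (true ∷ p)  q = cong suc (∣++∣ p q)
∣++∣ (false ∷ p) q = ∣++∣ p q

∣concat∣-cong : (S T : Vec (Subset k) m) →
                (∀ g → ∣ lookup S g ∣ ≡ ∣ lookup T g ∣) → ∣ concat S ∣ ≡ ∣ concat T ∣
∣concat∣-cong []      []      _ = refl
∣concat∣-cong (A ∷ S) (B ∷ T) e = begin
  ∣ A ++ concat S ∣       ≡⟨ ∣++∣ A (concat S) ⟩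
  ∣ A ∣ + ∣ concat S ∣    ≡⟨ cong₂ _+_ (e zero) (∣concat∣-cong S T (λ g → e (suc g))) ⟩
  ∣ B ∣ + ∣ concat T ∣    ≡⟨ ∣++∣ B (concat T) ⟨
  ∣ B ++ concat T ∣       ∎
  where open ≡-Reasoning

∣concat∣≤ : (S : Vec (Subset k) m) {b : ℕ} → (∀ g → ∣ lookup S g ∣ ≤ b) → ∣ concat S ∣ ≤ m * b
∣concat∣≤ []      _     = z≤n
∣concat∣≤ (A ∷ S) bound = ≤-trans (≤-reflexive (∣++∣ A (concat S)))
                                  (+-mono-≤ (bound zero) (∣concat∣≤ S (λ g → bound (suc g))))

∣concat-replicate∣ : ∀ m (A : Subset k) → ∣ concat (replicate m A) ∣ ≡ m * ∣ A ∣
∣concat-replicate∣ zero    A = refl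
∣concat-replicate∣ (suc m) A = trans (∣++∣ A _) (cong (∣ A ∣ +_) (∣concat-replicate∣ m A))

module _ {G H : Graph} where

  open Blocks (n G) (n H)

  adj-combine : ∀ g {a b} → Adj H a b → Adj (G ∘ₗ H) (combine g a) (combine g b)
  adj-combine g {a} {b} a~b =
    inj₂ ( trans (row-combine g a) (sym (row-combine g b))
         , subst₂ (Adj H) (sym (col-combine g a)) (sym (col-combine g b)) a~b )

  forest-lookup : ∀ (S : Vec (Subset (n H)) (n G)) →
                  Forest (G ∘ₗ H) (concat S) → ∀ g → Forest H (lookup S g)
  forest-lookup S F g C = F record
    { len   = len
    ; c     = λ i → combine g (c i)
    ; inj   = λ {i} {j} e → inj (combine-injectiveʳ g (c i) g (c j) e)
    ; inX   = λ i → ∈-concat⁺ S (inX i)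
    ; step  = λ i → adj-combine g (step i)
    ; close = adj-combine g close
    }
    where open CycleIn C

  forest-slices : {X : Subset (n G * n H)} →
                  Forest (G ∘ₗ H) X → ∀ g → Forest H (lookup (slices X) g)
  forest-slices {X} = forest-lookup (slices X) ∘ subst (Forest (G ∘ₗ H)) (sym (concat-slices X))

module _ {G H : Graph} (edgeless : Edgeless G) where

  open Blocks (n G) (n H)

  private
    GH : Graph
    GH = G ∘ₗ H

  adj-row : ∀ {u v} → Adj GH u v → row u ≡ row v
  adj-row (inj₁ g~g′)    = ⊥-elim (edgeless _ _ g~g′)
  adj-row (inj₂ (e , _)) = e

  adj-col : ∀ {u v} → Adj GH u v → Adj H (col u) (col v)
  adj-col (inj₁ g~g′)    = ⊥-elim (edgeless _ _ g~g′)
  adj-col (inj₂ (_ , a)) = a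

  cycle-row : ∀ {X} (C : CycleIn GH X) → ∀ i → row (CycleIn.c C i) ≡ row (CycleIn.c C zero)
  cycle-row C = <-weakInduction (λ i → row (c i) ≡ row (c zero)) refl
                  (λ i ih → trans (sym (adj-row (step i))) ih)
    where open CycleIn C

  forest-concat : ∀ (S : Vec (Subset (n H)) (n G)) →
                  (∀ g → Forest H (lookup S g)) → Forest GH (concat S)
  forest-concat S F C = F (row (c zero)) record
    { len   = len
    ; c     = λ i → col (c i)
    ; inj   = λ {i} {j} e → inj (begin
                c i                             ≡⟨ combine-row-col (c i) ⟨
                combine (row (c i)) (col (c i)) ≡⟨ cong₂ combine (trans (same-row i) (sym (same-row j))) e ⟩
                combine (row (c j)) (col (c j)) ≡⟨ combine-row-col (c j) ⟩
                c j                             ∎)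
    ; inX   = λ i → subst (λ g → col (c i) ∈ lookup S g) (same-row i) (∈-concat⁻′ S (inX i))
    ; step  = λ i → adj-col (step i)
    ; close = adj-col close
    }
    where
      open CycleIn C
      open ≡-Reasoning
      same-row : ∀ i → row (c i) ≡ row (c zero)
      same-row = cycle-row C

  maximal-lookup : ∀ (S : Vec (Subset (n H)) (n G)) →
                   MaximalForest GH (concat S) → ∀ g → MaximalForest H (lookup S g)
  maximal-lookup S (F , M) g = forest-lookup S F g , λ Z Sg⊂Z FZ →
    M (concat (S [ g ]≔ Z)) (concat-⊂-update S Sg⊂Z)
      (forest-concat (S [ g ]≔ Z) (∀-update (λ _ → Forest H) S FZ (forest-lookup S F)))

  maximal-slices : {X : Subset (n G * n H)} →
                   MaximalForest GH X → ∀ g → MaximalForest H (lookup (slices X) g)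
  maximal-slices {X} = maximal-lookup (slices X) ∘ subst (MaximalForest GH) (sym (concat-slices X))

  forest-replicate : {A : Subset (n H)} → Forest H A → Forest GH (concat (replicate (n G) A))
  forest-replicate {A} FA =
    forest-concat (replicate (n G) A) (λ g → subst (Forest H) (sym (lookup-replicate g A)) FA)

  maximal-replicate : {A : Subset (n H)} →
                      MaximalForest H A → MaximalForest GH (concat (replicate (n G) A))
  maximal-replicate {A} (FA , MA) = forest-replicate FA , λ Y R⊂Y FY →
    let R = replicate (n G) A
        g , Ag⊂Yg = concat-⊂⁻ R (slices Y) (subst (concat R ⊂_) (sym (concat-slices Y)) R⊂Y)
    in MA (lookup (slices Y) g) (subst (_⊂ lookup (slices Y) g) (lookup-replicate g A) Ag⊂Yg)
          (forest-slices FY g)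

  wellFCovered-∘ₗ⁺ : WellFCovered H → WellFCovered GH
  wellFCovered-∘ₗ⁺ W X Y MX MY = begin
    ∣ X ∣                    ≡⟨ ∣concat-slices∣ X ⟨
    ∣ concat (slices X) ∣    ≡⟨ ∣concat∣-cong (slices X) (slices Y)
                                  (λ g → W _ _ (maximal-slices MX g) (maximal-slices MY g)) ⟩
    ∣ concat (slices Y) ∣    ≡⟨ ∣concat-slices∣ Y ⟩
    ∣ Y ∣                    ∎
    where open ≡-Reasoning

  wellFCovered-∘ₗ⁻ : 1 ≤ n G → WellFCovered GH → WellFCovered H
  wellFCovered-∘ₗ⁻ 1≤m W A B MA MB = *-cancelˡ-≡ ∣ A ∣ ∣ B ∣ (n G) {{>-nonZero 1≤m}} (begin
    n G * ∣ A ∣                           ≡⟨ ∣concat-replicate∣ (n G) A ⟨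
    ∣ concat (replicate (n G) A) ∣        ≡⟨ W _ _ (maximal-replicate MA) (maximal-replicate MB) ⟩
    ∣ concat (replicate (n G) B) ∣        ≡⟨ ∣concat-replicate∣ (n G) B ⟩
    n G * ∣ B ∣                           ∎)
    where open ≡-Reasoning

  forestNumber-∘ₗ : ∀ f → IsForestNumber H f → IsForestNumber GH (n G * f)
  forestNumber-∘ₗ f ((A , FA , ∣A∣≡f) , bound) =
    (concat (replicate (n G) A) , forest-replicate FA ,
       trans (∣concat-replicate∣ (n G) A) (cong (n G *_) ∣A∣≡f)) ,
    λ X FX → ≤-trans (≤-reflexive (sym (∣concat-slices∣ X)))
                     (∣concat∣≤ (slices X) (λ g → bound _ (forest-slices FX g)))

theorem3p1 : (G : Graph) → 1 ≤ n G → Edgeless G → (H : Graph) →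
    (WellFCovered (G ∘ₗ H) ⇔ WellFCovered H)
    × (∀ k → IsForestNumber H k → IsForestNumber (G ∘ₗ H) (n G * k))
theorem3p1 G 1≤m edgeless H =
  mk⇔ (wellFCovered-∘ₗ⁻ edgeless 1≤m) (wellFCovered-∘ₗ⁺ edgeless) ,
  forestNumber-∘ₗ edgeless
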